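{- Let $G=(V,E)$ be a finite graph and $k>0$ an integer, and let $\mathcal F_k=\{\sigma\subseteq\vec S_k:\sigma=\{(A_i,B_i):i=0,\dots,n\}\text{ is a star with }|\bigcap_{i=0}^nB_i|<k\}$. Then $\mathcal F_k$ is closed under shifting.
   Context: A (vertex) separation of $G$ is an ordered pair $(A,B)$ with $A\cup B=V$ and no edge between $A\setminus B$ and $B\setminus A$; inverse $(B,A)$; unoriented $\{A,B\}$. The set $\vec U$ of all separations is a universe: $(A,B)\le(C,D)$ iff $A\subseteq C,B\supseteq D$, with supremum $(A,B)\vee(C,D)=(A\cup C,B\cap D)$ and infimum $(A\cap C,B\cup D)$. $\vec S_k$ is the set of $(A,B)$ with $|A\cap B|<k$ and $S_k$ the corresponding unoriented separations. For an oriented separation $\vec s$, $\overleftarrow s$ is its inverse; $s$ is degenerate if $\vec s=\overleftarrow s$. $\vec r$ is trivial in $\vec S_k$ if some $s\in S_k$ has $\vec r<\vec s$ and $\vec r<\overleftarrow s$. A star is a nonempty set $\sigma$ with $\vec r\le\overleftarrow s$ for all distinct $\vec r,\vec s\in\sigma$. $\mathcal F$ forces $\vec r$ if $\{\overleftarrow r\}\in\mathcal F$ or $r$ is degenerate. For nontrivial nondegenerate $\vec r\in\vec S_k$ and $\vec s_0\in\vec S_k$ with $\vec r\le\vec s_0$: $\vec S_{\ge\vec r}$ is the set of orientations of those $s\in S_k$ with an orientation $\vec s\ge\vec r$; the shifting map $f^{\vec r}_{\vec s_0}:\vec S_{\ge\vec r}\to\vec U$ is $f(\vec s)=\vec s\vee\vec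 s_0$, $f(\overleftarrow s)=(\vec s\vee\vec s_0)^*$ (inverse) for each $\vec s\ge\vec r$ in $\vec S_{\ge\vec r}\setminus\{\overleftarrow r\}$. $\vec s_0$ is linked to $\vec r$ if $\vec s_0\ge\vec r$ and $\vec s\vee\vec s_0\in\vec S_k$ for all $\vec s\in\vec S_k$ with $\vec s\ge\vec r$, $\vec s\ne\overleftarrow r$. $\vec s_0$ is $\mathcal F$-linked to $\vec r$ if it is linked to $\vec r$ and $f^{\vec r}_{\vec s_0}(\sigma)\in\mathcal F$ for every star $\sigma\in\mathcal F$ with $\sigma\subseteq\vec S_{\ge\vec r}\setminus\{\overleftarrow r\}$ having an element $\ge\vec r$. $\mathcal F$ is closed under shifting if whenever $\vec s_0\in\vec S_k$ is linked to some $\vec r\le\vec s_0$ not forced by $\mathcal F$, then $\vec s_0$ is $\mathcal F$-linked to $\vec r$. -}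

module Defs where

open import Data.Nat using (ℕ; _<_)
open import Data.Fin using (Fin)
open import Data.Fin.Subset using (Subset; _∈_; _∉_; _⊆_; _∩_; _∪_; ⊤; ∣_∣)
open import Data.Fin.Subset.Properties using (_⊆?_)
open import Data.Bool using (Bool; _≟_)
open import Data.Vec.Properties using (≡-dec)
open import Data.Product using (Σ; ∃; _×_; _,_; proj₁; proj₂)
import Data.Product.Properties as PP
open import Data.Sum using (_⊎_)
open import Data.List using (List; []; _∷_; map; foldr)
open import Data.List.Membership.Propositional using () renaming (_∈_ to _∈ₗ_)
open import Data.List.Relation.Unary.All using (All)
open import Relation.Nullary using (¬_; Dec; yes; no)
open import Relation.Nullary.Decidable using (_×-dec_)
open import Relation.Binary.PropositionalEquality using (_≡_; _≢_)

record Graph (n : ℕ) : Set₁ where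
  field
    E     : Fin n → Fin n → Set
    sym   : ∀ {u v} → E u v → E v u
    irrefl : ∀ {v} → ¬ E v v

-- Oriented "separations" as raw pairs (A , B) of vertex sets.
-- Whether such a pair really is a separation of G is the predicate IsSep.

Sep : ℕ → Set
Sep n = Subset n × Subset n

module _ {n : ℕ} where

  inv : Sep n → Sep n
  inv (A , B) = (B , A)

  _≤ₛ_ : Sep n → Sep n → Set
  (A , B) ≤ₛ (C , D) = A ⊆ C × D ⊆ B

  _<ₛ_ : Sep n → Sep n → Set
  r <ₛ s = r ≤ₛ s × r ≢ s

  _≤ₛ?_ : (r s : Sep n) → Dec (r ≤ₛ s)
  (A , B) ≤ₛ? (C , D) = (A ⊆? C) ×-dec (D ⊆? B)

  _≟ₛ_ : (r s : Sep n) → Dec (r ≡ s)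
  _≟ₛ_ = PP.≡-dec (≡-dec _≟_) (≡-dec _≟_)

  _∨ₛ_ : Sep n → Sep n → Sep n
  (A , B) ∨ₛ (C , D) = (A ∪ C , B ∩ D)

  Degenerate : Sep n → Set
  Degenerate s = s ≡ inv s

  order : Sep n → ℕ
  order (A , B) = ∣ A ∩ B ∣

  IsStar : List (Sep n) → Set
  IsStar σ = (σ ≢ []) × (∀ {r s} → r ∈ₗ σ → s ∈ₗ σ → r ≢ s → r ≤ₛ inv s)

  ⋂B : List (Sep n) → Subset n
  ⋂B σ = foldr (λ s X → proj₂ s ∩ X) ⊤ σ

  Family : Set₁
  Family = List (Sep n) → Set

  Forces : Family → Sep n → Set
  Forces F r = F (inv r ∷ []) ⊎ Degenerate r

  -- the shifting map f^{r}_{s0}, on S⃗_{≥r} ∖ {r⃖}: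
  --   f(s) = s ∨ s0            if s ≥ r (and s ≠ r⃖),
  --   f(s) = (s⃖ ∨ s0)⃖        otherwise (then s⃖ ≥ r).
  shift : Sep n → Sep n → Sep n → Sep n
  shift r s0 x with r ≤ₛ? x | x ≟ₛ inv r
  ... | yes _ | no _ = x ∨ₛ s0
  ... | _     | _    = inv (inv x ∨ₛ s0)

module _ {n : ℕ} (G : Graph n) where
  open Graph G

  IsSep : Sep n → Set
  IsSep (A , B) =
    (∀ v → v ∈ A ⊎ v ∈ B) ×
    (∀ u v → u ∈ A → u ∉ B → v ∈ B → v ∉ A → ¬ E u v)

  InS : ℕ → Sep n → Set
  InS k s = IsSep s × order s < k

  Trivial : ℕ → Sep n → Set
  Trivial k r = ∃ λ s → InS k s × r <ₛ s × r <ₛ inv s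

  InS≥ : ℕ → Sep n → Sep n → Set
  InS≥ k r x = InS k x × (r ≤ₛ x ⊎ r ≤ₛ inv x)

  Linked : ℕ → Sep n → Sep n → Set
  Linked k r s0 =
    r ≤ₛ s0 × (∀ s → InS k s → r ≤ₛ s → s ≢ inv r → InS k (s ∨ₛ s0))

  FLinked : ℕ → Family → Sep n → Sep n → Set
  FLinked k F r s0 =
    Linked k r s0 ×
    (∀ σ → IsStar σ → F σ →
       All (λ x → InS≥ k r x × x ≢ inv r) σ →
       (∃ λ x → x ∈ₗ σ × r ≤ₛ x) →
       F (map (shift r s0) σ))

  ClosedUnderShifting : ℕ → Family → Set
  ClosedUnderShifting k F =
    ∀ r s0 → InS k r → ¬ Trivial k r → ¬ Degenerate r → InS k s0 →
    r ≤ₛ s0 → ¬ Forces F r → Linked k r s0 → FLinked k F r s0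

  𝓕 : ℕ → Family
  𝓕 k σ = All (InS k) σ × IsStar σ × ∣ ⋂B σ ∣ < k

-- Fix a nontrivial r⃗ and s⃗₀ = (C , D) linked to r⃗, and write f for the
-- shifting map.  For a star σ ∈ 𝓕_k inside S⃗_{≥r} ∖ {r⃖} with an element
-- x₀ = (A₀ , B₀) ≥ r⃗ we check the three defining conditions of 𝓕_k for f(σ):
--   * f(σ) ⊆ S⃗_k: this is exactly linkedness (applied to x or to x⃖);
--   * f(σ) is a star: since r⃗ is nontrivial, at most one element of σ lies
--     above r⃗; the other elements are moved down by x ↦ (x⃖ ∨ s⃗₀)⃖ and the
--     star inequalities survive by monotonicity of ∨ and antitonicity of ⃖;
--   * |⋂ f(σ)| < k: with O = ⋂_{x∈σ} B_x, the pair s = (A₀ ∪ O , B₀) is a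
--     separation of order ≤ |O| < k lying above r⃗, so s ∨ s⃗₀ ∈ S⃗_k by
--     linkedness, and the intersection of the second components of f(σ)
--     is contained in the separator ((A₀ ∪ O) ∪ C) ∩ (B₀ ∩ D) of s ∨ s⃗₀.
module Submission where

open import Defs
open import Data.Nat using (ℕ; _<_)
open import Data.Nat.Properties using (≤-<-trans)
open import Data.Fin.Subset using (Subset; _∈_; _∉_; _⊆_; _∩_; _∪_; ∣_∣)
open import Data.Fin.Subset.Properties
  using (x∈p∩q⁺; x∈p∩q⁻; x∈p∪q⁻; p⊆p∪q; q⊆p∪q; p∩q⊆p; ⊆-antisym; ∈⊤; p⊆q⇒∣p∣≤∣q∣)
open import Data.Product using (∃; _×_; _,_; proj₁; proj₂)
open import Data.Sum using (inj₁; inj₂; [_,_]′; swap)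
open import Data.List using (List; []; _∷_; map)
open import Data.List.Membership.Propositional using () renaming (_∈_ to _∈ₗ_)
open import Data.List.Membership.Propositional.Properties using (∈-map⁺; ∈-map⁻)
open import Data.List.Relation.Unary.All as All using (All)
open import Data.List.Relation.Unary.All.Properties using (map⁺)
open import Data.List.Relation.Unary.Any using (here; there)
open import Data.Empty using (⊥; ⊥-elim)
open import Relation.Nullary using (¬_; yes; no)
open import Relation.Binary.PropositionalEquality using (_≡_; _≢_; refl; sym; cong; subst)

∪-monoˡ-⊆ : ∀ {n} {P Q : Subset n} (C : Subset n) → P ⊆ Q → P ∪ C ⊆ Q ∪ C
∪-monoˡ-⊆ {P = P} {Q} C P⊆Q v∈ =
  [ (λ p → p⊆p∪q C (P⊆Q p)) , q⊆p∪q Q C ]′ (x∈p∪q⁻ P C v∈)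

∩-monoˡ-⊆ : ∀ {n} {P Q : Subset n} (D : Subset n) → P ⊆ Q → P ∩ D ⊆ Q ∩ D
∩-monoˡ-⊆ {P = P} D P⊆Q v∈ with x∈p∩q⁻ P D v∈
... | p , d = x∈p∩q⁺ (P⊆Q p , d)

∩-swap-⊆ : ∀ {n} (P Q : Subset n) → P ∩ Q ⊆ Q ∩ P
∩-swap-⊆ P Q v∈ with x∈p∩q⁻ P Q v∈
... | p , q = x∈p∩q⁺ (q , p)

module _ {n : ℕ} where

  ≤ₛ-refl : (x : Sep n) → x ≤ₛ x
  ≤ₛ-refl x = (λ v∈ → v∈) , (λ v∈ → v∈)

  ≤ₛ-trans : {x y z : Sep n} → x ≤ₛ y → y ≤ₛ z → x ≤ₛ z
  ≤ₛ-trans (A⊆C , D⊆B) (C⊆E , F⊆D) = (λ v∈ → C⊆E (A⊆C v∈)) , (λ v∈ → D⊆B (F⊆D v∈))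

  inv-antitone : {x y : Sep n} → x ≤ₛ y → inv y ≤ₛ inv x
  inv-antitone (A⊆C , D⊆B) = D⊆B , A⊆C

  ∨ₛ-upper : (x s : Sep n) → x ≤ₛ (x ∨ₛ s)
  ∨ₛ-upper (A , B) (C , D) = p⊆p∪q C , p∩q⊆p B D

  ∨ₛ-monoˡ : {x y : Sep n} (s : Sep n) → x ≤ₛ y → (x ∨ₛ s) ≤ₛ (y ∨ₛ s)
  ∨ₛ-monoˡ (C , D) (A⊆A' , B'⊆B) = ∪-monoˡ-⊆ C A⊆A' , ∩-monoˡ-⊆ D B'⊆B

  ⋂B-lower : (σ : List (Sep n)) {y : Sep n} → y ∈ₗ σ → ⋂B σ ⊆ proj₂ y
  ⋂B-lower (s ∷ σ) (here refl) v∈ = proj₁ (x∈p∩q⁻ (proj₂ s) (⋂B σ) v∈)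
  ⋂B-lower (s ∷ σ) (there y∈) v∈ = ⋂B-lower σ y∈ (proj₂ (x∈p∩q⁻ (proj₂ s) (⋂B σ) v∈))

  ⋂B-greatest : (σ : List (Sep n)) {v : _} →
                (∀ {y} → y ∈ₗ σ → v ∈ proj₂ y) → v ∈ ⋂B σ
  ⋂B-greatest [] _ = ∈⊤
  ⋂B-greatest (s ∷ σ) below = x∈p∩q⁺ (below (here refl) , ⋂B-greatest σ (λ y∈ → below (there y∈)))

  ⋂B-map-⊆ : (g : Sep n → Sep n) (C : Subset n) →
             (∀ y → proj₂ (g y) ⊆ proj₂ y ∪ C) →
             (σ : List (Sep n)) → ⋂B (map g σ) ⊆ ⋂B σ ∪ C
  ⋂B-map-⊆ g C g⊆ [] v∈ = p⊆p∪q C ∈⊤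
  ⋂B-map-⊆ g C g⊆ (s ∷ σ) v∈
    with x∈p∩q⁻ (proj₂ (g s)) (⋂B (map g σ)) v∈
  ... | v∈gs , v∈rest
    with x∈p∪q⁻ (proj₂ s) C (g⊆ s v∈gs) | x∈p∪q⁻ (⋂B σ) C (⋂B-map-⊆ g C g⊆ σ v∈rest)
  ... | inj₂ c | _      = q⊆p∪q _ C c
  ... | inj₁ _ | inj₂ c = q⊆p∪q _ C c
  ... | inj₁ b | inj₁ o = p⊆p∪q C (x∈p∩q⁺ (b , o))

  star-separator-⊆-⋂B : {σ : List (Sep n)} → IsStar σ →
                        {A₀ B₀ : Subset n} → (A₀ , B₀) ∈ₗ σ → A₀ ∩ B₀ ⊆ ⋂B σ
  star-separator-⊆-⋂B {σ} (_ , star) {A₀} {B₀} x₀∈ {v} v∈ =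
    ⋂B-greatest σ in-every
    where
      in-every : ∀ {y} → y ∈ₗ σ → v ∈ proj₂ y
      in-every {y} y∈ with y ≟ₛ (A₀ , B₀)
      ... | yes refl = proj₂ (x∈p∩q⁻ A₀ B₀ v∈)
      ... | no y≢x₀  = proj₁ (star x₀∈ y∈ (λ e → y≢x₀ (sym e))) (proj₁ (x∈p∩q⁻ A₀ B₀ v∈))

  map-≢-[] : {σ : List (Sep n)} (g : Sep n → Sep n) → σ ≢ [] → map g σ ≢ []
  map-≢-[] {[]}    g σ≢[] _ = σ≢[] refl
  map-≢-[] {_ ∷ _} g σ≢[] ()

  ∪-separator-⊆ : {A B X : Subset n} → A ∩ B ⊆ X → (A ∪ X) ∩ B ⊆ X
  ∪-separator-⊆ {A} {B} {X} A∩B⊆X v∈ with x∈p∩q⁻ (A ∪ X) B v∈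
  ... | v∈A∪X , v∈B = [ (λ a → A∩B⊆X (x∈p∩q⁺ (a , v∈B))) , (λ x → x) ]′ (x∈p∪q⁻ A X v∈A∪X)

  ∪-≢-inv : {A B X : Subset n} (r : Sep n) → r ≤ₛ (A , B) → (A , B) ≢ inv r →
            X ⊆ B → (A ∪ X , B) ≢ inv r
  ∪-≢-inv {A} {B} {X} (.B , .(A ∪ X)) (B⊆A , _) x≢r⃖ X⊆B refl =
    x≢r⃖ (cong (_, B) (⊆-antisym (p⊆p∪q X) A∪X⊆A))
    where
      A∪X⊆A : A ∪ X ⊆ A
      A∪X⊆A v∈ = [ (λ a → a) , (λ x → B⊆A (X⊆B x)) ]′ (x∈p∪q⁻ A X v∈)

module _ {n : ℕ} (G : Graph n) where
  open Graph G using () renaming (sym to E-sym)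

  inv-IsSep : ∀ {s} → IsSep G s → IsSep G (inv s)
  inv-IsSep (covers , no-edge) =
    (λ v → swap (covers v)) , (λ u v u∈B u∉A v∈A v∉B e → no-edge v u v∈A v∉B u∈B u∉A (E-sym e))

  inv-InS : ∀ {k s} → InS G k s → InS G k (inv s)
  inv-InS {s = A , B} (sep , ord) =
    inv-IsSep sep , ≤-<-trans (p⊆q⇒∣p∣≤∣q∣ (∩-swap-⊆ B A)) ord

  ∪-IsSep : {A B X : Subset n} → IsSep G (A , B) → X ⊆ B → IsSep G (A ∪ X , B)
  ∪-IsSep {A} {B} {X} (covers , no-edge) X⊆B =
    (λ v → [ (λ a → inj₁ (p⊆p∪q X a)) , inj₂ ]′ (covers v)) , no-edge′
    where
      no-edge′ : ∀ u v → u ∈ A ∪ X → u ∉ B → v ∈ B → v ∉ A ∪ X → ¬ Graph.E G u v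
      no-edge′ u v u∈ u∉B v∈B v∉ =
        [ (λ a → no-edge u v a u∉B v∈B (λ va → v∉ (p⊆p∪q X va)))
        , (λ x → ⊥-elim (u∉B (X⊆B x))) ]′ (x∈p∪q⁻ A X u∈)

-- The view is indexed by the value of
-- the map, so that matching on it reveals what shift r s₀ x computes to.

data ShiftView {n : ℕ} (r s₀ x : Sep n) : Sep n → Set where
  up   : r ≤ₛ x → ShiftView r s₀ x (x ∨ₛ s₀)
  down : ¬ r ≤ₛ x → ShiftView r s₀ x (inv (inv x ∨ₛ s₀))

shiftView : ∀ {n} (r s₀ x : Sep n) → x ≢ inv r → ShiftView r s₀ x (shift r s₀ x)
shiftView r s₀ x x≢r⃖ with r ≤ₛ? x | x ≟ₛ inv r
... | yes r≤x | no _     = up r≤x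
... | yes _   | yes x≡r⃖ = ⊥-elim (x≢r⃖ x≡r⃖)
... | no r≰x  | _        = down r≰x

-- Writing s⃗₀ = (C , D), every second component grows by at most C under
-- shifting: it becomes B ∩ D or B ∪ C.
shift-B-⊆ : ∀ {n} (r s₀ y : Sep n) → proj₂ (shift r s₀ y) ⊆ proj₂ y ∪ proj₁ s₀
shift-B-⊆ r (C , D) y with r ≤ₛ? y | y ≟ₛ inv r
... | yes _ | no _  = λ v∈ → p⊆p∪q C (proj₁ (x∈p∩q⁻ (proj₂ y) D v∈))
... | yes _ | yes _ = λ v∈ → v∈
... | no _  | _     = λ v∈ → v∈

module Shifting {n : ℕ} (G : Graph n) (k : ℕ) (r s₀ : Sep n) where

  Admissible : Sep n → Set
  Admissible x = InS≥ G k r x × x ≢ inv r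

  shift-InS : Linked G k r s₀ → ∀ {x} → Admissible x → InS G k (shift r s₀ x)
  shift-InS (_ , linked) {x} ((x∈S , r≤x⊎r≤x⃖) , x≢r⃖)
    with shift r s₀ x | shiftView r s₀ x x≢r⃖
  ... | _ | up r≤x   = linked x x∈S r≤x x≢r⃖
  ... | _ | down r≰x = inv-InS G (linked (inv x) (inv-InS G x∈S) r≤x⃖ x⃖≢r⃖)
    where
      r≤x⃖ : r ≤ₛ inv x
      r≤x⃖ = [ (λ r≤x → ⊥-elim (r≰x r≤x)) , (λ r≤x⃖ → r≤x⃖) ]′ r≤x⊎r≤x⃖
      x⃖≢r⃖ : inv x ≢ inv r
      x⃖≢r⃖ x⃖≡r⃖ = r≰x (subst (r ≤ₛ_) (sym (cong inv x⃖≡r⃖)) (≤ₛ-refl r))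

  -- Two distinct members of a star that both lie above r⃗ would witness
  -- that r⃗ is trivial.
  at-most-one-above : ¬ Trivial G k r → ∀ {x y} → InS G k x → InS G k y →
                      x ≢ inv r → y ≢ inv r → x ≢ y → x ≤ₛ inv y → y ≤ₛ inv x →
                      r ≤ₛ x → r ≤ₛ y → ⊥
  at-most-one-above nontrivial {x} {y} x∈S y∈S x≢r⃖ y≢r⃖ x≢y x≤y⃖ y≤x⃖ r≤x r≤y
    with r ≟ₛ y
  ... | no r≢y   = nontrivial (y , y∈S , (r≤y , r≢y) ,
                     (≤ₛ-trans r≤x x≤y⃖ , λ r≡y⃖ → y≢r⃖ (cong inv (sym r≡y⃖))))
  ... | yes refl = nontrivial (x , x∈S , (r≤x , λ r≡x → x≢y (sym r≡x)) ,
                     (y≤x⃖ , λ r≡x⃖ → x≢r⃖ (cong inv (sym r≡x⃖))))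

  shift-≤-inv : ¬ Trivial G k r → ∀ {x y} → InS G k x → InS G k y →
                x ≢ inv r → y ≢ inv r → x ≢ y → x ≤ₛ inv y → y ≤ₛ inv x →
                shift r s₀ x ≤ₛ inv (shift r s₀ y)
  shift-≤-inv nontrivial {x} {y} x∈S y∈S x≢r⃖ y≢r⃖ x≢y x≤y⃖ y≤x⃖ =
    by-views (shiftView r s₀ x x≢r⃖) (shiftView r s₀ y y≢r⃖)
    where
      by-views : ∀ {fx fy} → ShiftView r s₀ x fx → ShiftView r s₀ y fy → fx ≤ₛ inv fy
      by-views (up r≤x) (up r≤y) =
        ⊥-elim (at-most-one-above nontrivial x∈S y∈S x≢r⃖ y≢r⃖ x≢y x≤y⃖ y≤x⃖ r≤x r≤y)
      by-views (up _) (down _) = ∨ₛ-monoˡ s₀ x≤y⃖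
      by-views (down _) (up _) = inv-antitone (∨ₛ-monoˡ s₀ y≤x⃖)
      by-views (down _) (down _) =
        ≤ₛ-trans (inv-antitone (∨ₛ-upper (inv x) s₀))
                 (≤ₛ-trans x≤y⃖ (∨ₛ-upper (inv y) s₀))

  shift-star : ¬ Trivial G k r → ∀ {σ} → IsStar σ → All Admissible σ →
               IsStar (map (shift r s₀) σ)
  shift-star nontrivial {σ} (nonempty , star) adm =
    map-≢-[] (shift r s₀) nonempty , star′
    where
      star′ : ∀ {a b} → a ∈ₗ map (shift r s₀) σ → b ∈ₗ map (shift r s₀) σ →
              a ≢ b → a ≤ₛ inv b
      star′ a∈ b∈ a≢b with ∈-map⁻ (shift r s₀) a∈ | ∈-map⁻ (shift r s₀) b∈
      ... | x , x∈ , refl | y , y∈ , refl =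
        shift-≤-inv nontrivial
          (proj₁ (proj₁ (All.lookup adm x∈))) (proj₁ (proj₁ (All.lookup adm y∈)))
          (proj₂ (All.lookup adm x∈)) (proj₂ (All.lookup adm y∈))
          x≢y (star x∈ y∈ x≢y) (star y∈ x∈ (λ y≡x → x≢y (sym y≡x)))
        where
          x≢y : x ≢ y
          x≢y x≡y = a≢b (cong (shift r s₀) x≡y)

  -- The bound on ⋂B of the image, via the separation s = (A₀ ∪ O , B₀)
  -- where O = ⋂B σ and x₀ = (A₀ , B₀) ∈ σ lies above r⃗.
  shift-⋂B-bound : Linked G k r s₀ → (σ : List (Sep n)) → IsStar σ →
                   ∣ ⋂B σ ∣ < k → All Admissible σ →
                   ∀ {A₀ B₀} → (A₀ , B₀) ∈ₗ σ → r ≤ₛ (A₀ , B₀) →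
                   ∣ ⋂B (map (shift r s₀) σ) ∣ < k
  shift-⋂B-bound (_ , linked) σ star ⋂B<k adm {A₀} {B₀} x₀∈ r≤x₀ =
    ≤-<-trans (p⊆q⇒∣p∣≤∣q∣ image⊆separator) (proj₂ (linked s s∈S r≤s s≢r⃖))
    where
      O : Subset n
      O = ⋂B σ
      O⊆B₀ : O ⊆ B₀
      O⊆B₀ = ⋂B-lower σ x₀∈
      s : Sep n
      s = (A₀ ∪ O , B₀)
      s∈S : InS G k s
      s∈S = ∪-IsSep G (proj₁ (proj₁ (proj₁ (All.lookup adm x₀∈)))) O⊆B₀
          , ≤-<-trans (p⊆q⇒∣p∣≤∣q∣ (∪-separator-⊆ (star-separator-⊆-⋂B star x₀∈))) ⋂B<k
      r≤s : r ≤ₛ s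
      r≤s = ≤ₛ-trans r≤x₀ (p⊆p∪q O , λ v∈ → v∈)
      s≢r⃖ : s ≢ inv r
      s≢r⃖ = ∪-≢-inv r r≤x₀ (proj₂ (All.lookup adm x₀∈)) O⊆B₀
      up-B-⊆ : ∀ {fx} → ShiftView r s₀ (A₀ , B₀) fx → proj₂ fx ⊆ B₀ ∩ proj₂ s₀
      up-B-⊆ (up _)       v∈ = v∈
      up-B-⊆ (down r≰x₀) _  = ⊥-elim (r≰x₀ r≤x₀)
      image⊆separator : ⋂B (map (shift r s₀) σ) ⊆ ((A₀ ∪ O) ∪ proj₁ s₀) ∩ (B₀ ∩ proj₂ s₀)
      image⊆separator v∈ = x∈p∩q⁺
        ( ∪-monoˡ-⊆ (proj₁ s₀) (q⊆p∪q A₀ O)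
            (⋂B-map-⊆ (shift r s₀) (proj₁ s₀) (shift-B-⊆ r s₀) σ v∈)
        , up-B-⊆ (shiftView r s₀ (A₀ , B₀) (proj₂ (All.lookup adm x₀∈)))
            (⋂B-lower (map (shift r s₀) σ) (∈-map⁺ (shift r s₀) x₀∈) v∈) )

  𝓕-linked : ¬ Trivial G k r → Linked G k r s₀ → FLinked G k (𝓕 G k) r s₀
  𝓕-linked nontrivial lk = lk , shift-preserves-𝓕
    where
      shift-preserves-𝓕 : ∀ σ → IsStar σ → 𝓕 G k σ → All Admissible σ →
                          (∃ λ x → x ∈ₗ σ × r ≤ₛ x) → 𝓕 G k (map (shift r s₀) σ)
      shift-preserves-𝓕 σ star (_ , _ , ⋂B<k) adm (_ , x₀∈ , r≤x₀) =
          map⁺ (All.map (shift-InS lk) adm)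
        , shift-star nontrivial star adm
        , shift-⋂B-bound lk σ star ⋂B<k adm x₀∈ r≤x₀

-- Lemma 5.6: every s⃗₀ linked to a nontrivial r⃗ is 𝓕_k-linked to it.
lemma5p6 : (n : ℕ) (G : Graph n) (k : ℕ) → 0 < k → ClosedUnderShifting G k (𝓕 G k)
lemma5p6 n G k _ r s₀ _ nontrivial _ _ _ _ linked =
  Shifting.𝓕-linked G k r s₀ nontrivial linked
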